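{- Let $M\subseteq\mathbb{T}$ satisfy the standing hypothesis. Then the complete core of $\rho^\forall_M$ for negation is the constant closure $\lambda X.\varnothing$; more precisely, $\lambda X.\varnothing$ is the only upper closure operator $\eta$ on $\langle\wp(\mathbb{T}),\supseteq\rangle$ with $\rho^\forall_M\sqsubseteq\eta$ and $\eta(\neg X)=\eta(\neg\,\eta(X))$ for all $X\subseteq\mathbb{T}$.
   Context: $\mathbb{T}$ is the set of traces $\langle i,\sigma\rangle$, $i\in\mathbb{Z}$, $\sigma:\mathbb{Z}\to\mathbb{S}$ for a set of states $\mathbb{S}$; $\neg X=\mathbb{T}\setminus X$; $X_{\downarrow s}=\{\langle i,\sigma\rangle\in X\mid\sigma_i=s\}$; $\oplus(X)=\{\langle i,\sigma\rangle\mid\langle i+1,\sigma\rangle\in X\}$, $\ominus(X)=\{\langle i,\sigma\rangle\mid\langle i-1,\sigma\rangle\in X\}$, $\curvearrowleft(X)=\{\langle -i,\lambda k.\sigma_{ -k}\rangle\mid\langle i,\sigma\rangle\in X\}$. Standing hypothesis on $M$: (i) $|M_{\downarrow s}|>1$ for all $s\in\mathbb{S}$; (ii) $\oplus(M)=M=\ominus(M)$ and $\oplus(\curvearrowleft M)=\curvearrowleft M=\ominus(\curvearrowleft M)$. Universal closure: $\rho^\forall_M(X)=\{\langle i,\sigma\rangle\in M\mid M_{\downarrow\sigma_i}\subseteq X\}$. An upper closure operator on $\langle\wp(\mathbb{T}),\supseteq\rangle$ is a map monotone w.r.t. $\subseteq$, idempotent, with $\rho(X)\subseteq X$; $\rho\sqsubseteq\eta$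 iff $\rho(X)\supseteq\eta(X)$ for all $X$. The complete core of $\rho$ for a function $f$ is the $\sqsubseteq$-least closure $\eta$ with $\rho\sqsubseteq\eta$ that is complete for $f$, i.e. $\eta\circ f=\eta\circ f\circ\eta$. -}

module Defs where

open import Data.Integer using (ℤ; _+_; _-_; -_; 1ℤ)
open import Data.Product using (Σ; _×_; _,_; ∃; proj₁; proj₂)
open import Relation.Binary.PropositionalEquality using (_≡_)
open import Relation.Nullary using (¬_)
open import Data.Empty using (⊥)

record Trace (S : Set) : Set where
  constructor ⟨_,_⟩
  field
    pos : ℤ
    σ   : ℤ → S
open Trace public

state : {S : Set} → Trace S → S
state t = σ t (pos t)

_≈ₜ_ : {S : Set} → Trace S → Trace S → Set
t ≈ₜ u = (pos t ≡ pos u) × (∀ k → σ t k ≡ σ u k)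

TSet : Set → Set₁
TSet S = Trace S → Set

_⊆_ : {S : Set} → TSet S → TSet S → Set
X ⊆ Y = ∀ t → X t → Y t

_≐_ : {S : Set} → TSet S → TSet S → Set
X ≐ Y = (X ⊆ Y) × (Y ⊆ X)

∅ : {S : Set} → TSet S
∅ _ = ⊥

∁ : {S : Set} → TSet S → TSet S
∁ X t = ¬ X t

_↓_ : {S : Set} → TSet S → S → TSet S
(X ↓ s) t = X t × (state t ≡ s)

⊕ : {S : Set} → TSet S → TSet S
⊕ X ⟨ i , s ⟩ = X ⟨ i + 1ℤ , s ⟩

⊖ : {S : Set} → TSet S → TSet S
⊖ X ⟨ i , s ⟩ = X ⟨ i - 1ℤ , s ⟩

↶ : {S : Set} → TSet S → TSet S
↶ X u = Σ (Trace _) λ t → X t × (u ≈ₜ ⟨ - pos t , (λ k → σ t (- k)) ⟩)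

MoreThanOne : {S : Set} → TSet S → Set
MoreThanOne {S} X =
  Σ (Trace S) λ t → Σ (Trace S) λ u → X t × X u × ¬ (t ≈ₜ u)

record StandingHyp {S : Set} (M : TSet S) : Set where
  field
    card   : ∀ (s : S) → MoreThanOne (M ↓ s)
    ⊕M     : ⊕ M ≐ M
    ⊖M     : ⊖ M ≐ M
    ⊕↶M    : ⊕ (↶ M) ≐ ↶ M
    ⊖↶M    : ⊖ (↶ M) ≐ ↶ M

ρ∀ : {S : Set} → TSet S → TSet S → TSet S
ρ∀ M X t = M t × ((M ↓ state t) ⊆ X)

-- upper closure operator on ⟨℘(𝕋), ⊇⟩
record IsUpperClosure {S : Set} (ρ : TSet S → TSet S) : Set₁ where
  field
    monotone   : ∀ {X Y} → X ⊆ Y → ρ X ⊆ ρ Y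
    idempotent : ∀ X → ρ (ρ X) ≐ ρ X
    reductive  : ∀ X → ρ X ⊆ X

_⊑_ : {S : Set} → (TSet S → TSet S) → (TSet S → TSet S) → Set₁
ρ ⊑ η = ∀ X → η X ⊆ ρ X

CompleteForNeg : {S : Set} → (TSet S → TSet S) → Set₁
CompleteForNeg η = ∀ X → η (∁ X) ≐ η (∁ (η X))

const∅ : {S : Set} → TSet S → TSet S
const∅ _ = ∅

{-# OPTIONS --safe #-}
-- Because every fibre M↓s has two distinct traces, ρ∀_M maps every singleton
-- {a} to ∅, hence so does any η above ρ∀_M. Completeness for negation then gives
-- η(¬{a}) = η(¬∅) = η(𝕋) ⊇ η(X). But a point t of η(¬{a}) lies in ρ∀_M(¬{a}),
-- which is impossible once a is chosen in the fibre of t's own state.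
module Submission where

open import Defs
open import Data.Product using (_×_; _,_; proj₂)
open import Data.Unit using (⊤; tt)
open import Relation.Binary.PropositionalEquality using (refl; sym; trans)
open import Relation.Nullary using (¬_)

≈ₜ-refl : {S : Set} {a : Trace S} → a ≈ₜ a
≈ₜ-refl = refl , λ _ → refl

≈ₜ-sym : {S : Set} {a b : Trace S} → a ≈ₜ b → b ≈ₜ a
≈ₜ-sym (p , f) = sym p , λ k → sym (f k)

≈ₜ-trans : {S : Set} {a b c : Trace S} → a ≈ₜ b → b ≈ₜ c → a ≈ₜ c
≈ₜ-trans (p , f) (q , g) = trans p q , λ k → trans (f k) (g k)

｛_｝ : {S : Set} → Trace S → TSet S
｛ a ｝ u = u ≈ₜ a

𝕋 : {S : Set} → TSet S
𝕋 _ = ⊤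

const∅-isUpperClosure : {S : Set} → IsUpperClosure {S} const∅
const∅-isUpperClosure = record
  { monotone   = λ _ _ ()
  ; idempotent = λ _ → (λ _ ()) , (λ _ ())
  ; reductive  = λ _ _ ()
  }

const∅-completeForNeg : {S : Set} → CompleteForNeg {S} const∅
const∅-completeForNeg _ = (λ _ ()) , (λ _ ())

ρ∀-singleton-empty : {S : Set} {M : TSet S} → (∀ s → MoreThanOne (M ↓ s)) →
                     ∀ a → ρ∀ M ｛ a ｝ ⊆ ∅
ρ∀-singleton-empty card a t (_ , fibre⊆｛a｝) with card (state t)
... | u , v , u∈M↓ , v∈M↓ , u≉v =
  u≉v (≈ₜ-trans (fibre⊆｛a｝ u u∈M↓) (≈ₜ-sym (fibre⊆｛a｝ v v∈M↓)))

fibre-point-∉-ρ∀-∁-singleton : {S : Set} {M : TSet S} {a t : Trace S} →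
                               (M ↓ state t) a → ¬ ρ∀ M (∁ ｛ a ｝) t
fibre-point-∉-ρ∀-∁-singleton a∈M↓ (_ , fibre⊆∁｛a｝) = fibre⊆∁｛a｝ _ a∈M↓ ≈ₜ-refl

completeForNeg-∁-of-empty : {S : Set} {η : TSet S → TSet S} → IsUpperClosure η →
                            CompleteForNeg η → ∀ {X} → η X ⊆ ∅ → η 𝕋 ⊆ η (∁ X)
completeForNeg-∁-of-empty C complete {X} ηX⊆∅ t t∈η𝕋 =
  proj₂ (complete X) t (monotone (λ u _ → ηX⊆∅ u) t t∈η𝕋)
  where open IsUpperClosure C

theorem5 : {S : Set} (M : TSet S) → StandingHyp M →
    (IsUpperClosure {S} const∅ × (ρ∀ M ⊑ const∅) × CompleteForNeg {S} const∅)
    × (∀ (η : TSet S → TSet S) → IsUpperClosure η → ρ∀ M ⊑ η → CompleteForNeg η →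
    ∀ X → η X ≐ const∅ X)
theorem5 M H =
  (const∅-isUpperClosure , (λ _ _ ()) , const∅-completeForNeg) , unique
  where
  open StandingHyp H using (card)
  unique : ∀ η → IsUpperClosure η → ρ∀ M ⊑ η → CompleteForNeg η → ∀ X → η X ≐ const∅ X
  unique η C ρ⊑η complete X = ηX⊆∅ , λ _ ()
    where
    open IsUpperClosure C using (monotone)
    ηX⊆∅ : η X ⊆ ∅
    ηX⊆∅ t t∈ηX with card (state t)
    ... | a , _ , a∈M↓ , _ = fibre-point-∉-ρ∀-∁-singleton a∈M↓ (ρ⊑η (∁ ｛ a ｝) t t∈η∁｛a｝)
      where
      η｛a｝⊆∅ : η ｛ a ｝ ⊆ ∅
      η｛a｝⊆∅ u u∈η｛a｝ = ρ∀-singleton-empty card a u (ρ⊑η ｛ a ｝ u u∈η｛a｝)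
      t∈η∁｛a｝ : η (∁ ｛ a ｝) t
      t∈η∁｛a｝ = completeForNeg-∁-of-empty C complete η｛a｝⊆∅ t (monotone (λ _ _ → tt) t t∈ηX)
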